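{- Let $G$ be a subcubic class two graph and let $f$ be a minimal colouring of $G$. Then for each conflicting edge $e$ with regard to $f$, there exists at least one minimal conflicting subgraph of $G$ which contains $e$ and contains no other conflicting edge with regard to $f$.
   Context: All graphs are finite. A graph is subcubic if every vertex has degree at most 3. A subcubic graph is class two if it has no proper 3-edge-colouring (so its maximum degree is 3 and it has a proper 4-edge-colouring). For such $G$, proper 4-edge-colourings use the colour set $\{0,1,2,3\}$, and the resistance $r(G)$ is the minimum, over all proper 4-edge-colourings $f$ of $G$ and all colours $i$, of $|f^{ -1}(i)|$. A minimal colouring of $G$ is a proper 4-edge-colouring $f$ with $|f^{ -1}(0)|=r(G)$; an edge $e$ is a conflicting edge with regard to $f$ if $f(e)=0$. A conflicting subgraph of $G$ is a subgraph admitting no proper 3-edge-colouring; it is a minimal conflicting subgraph if removing any one of its edges yields a 3-edge-colourable graph. -}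

module Defs where

open import Data.Nat using (ℕ; _≤_)
open import Data.Fin using (Fin; zero; _≟_)
open import Data.Bool using (Bool; true; false)
open import Data.List using (List; length; filter)
open import Data.Fin.Base using ()
open import Data.List.Base using ()
open import Data.Product using (Σ; _×_; ∃)
open import Data.Sum using (_⊎_)
open import Data.Empty using (⊥)
open import Relation.Nullary using (¬_)
open import Relation.Nullary.Decidable using (_⊎-dec_)
open import Relation.Binary.PropositionalEquality using (_≡_; _≢_)
open import Data.List using (allFin)

record Graph : Set where
  field
    n    : ℕ
    m    : ℕ
    end₁ : Fin m → Fin n
    end₂ : Fin m → Fin n
    loopless : ∀ e → end₁ e ≢ end₂ e
open Graph public

Incident : (G : Graph) → Fin (m G) → Fin (n G) → Set
Incident G e v = (end₁ G e ≡ v) ⊎ (end₂ G e ≡ v)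

-- number of edges incident with v (no loops, so this is the degree)
degree : (G : Graph) → Fin (n G) → ℕ
degree G v = length (filter (λ e → (end₁ G e ≟ v) ⊎-dec (end₂ G e ≟ v)) (allFin (m G)))

Subcubic : Graph → Set
Subcubic G = ∀ v → degree G v ≤ 3

Adjacent : (G : Graph) → Fin (m G) → Fin (m G) → Set
Adjacent G e e' = e ≢ e' × ∃ λ v → Incident G e v × Incident G e' v

-- A subgraph is represented by its edge set (colourability only depends on edges).
EdgeSet : Graph → Set
EdgeSet G = Fin (m G) → Bool

ProperOn : (G : Graph) (k : ℕ) → EdgeSet G → (Fin (m G) → Fin k) → Set
ProperOn G k S c = ∀ e e' → S e ≡ true → S e' ≡ true → Adjacent G e e' → c e ≢ c e'

allEdges : (G : Graph) → EdgeSet G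
allEdges G _ = true

Proper : (G : Graph) (k : ℕ) → (Fin (m G) → Fin k) → Set
Proper G k c = ProperOn G k (allEdges G) c

ThreeColourableOn : (G : Graph) → EdgeSet G → Set
ThreeColourableOn G S = Σ (Fin (m G) → Fin 3) λ c → ProperOn G 3 S c

ClassTwo : Graph → Set
ClassTwo G = ¬ ThreeColourableOn G (allEdges G)

colourCount : (G : Graph) {k : ℕ} → (Fin (m G) → Fin k) → Fin k → ℕ
colourCount G c i = length (filter (λ e → c e ≟ i) (allFin (m G)))

-- f is a minimal colouring: a proper 4-edge-colouring with |f⁻¹(0)| = r(G),
-- where r(G) = min over proper 4-colourings g and colours i of |g⁻¹(i)|.
MinimalColouring : (G : Graph) → (Fin (m G) → Fin 4) → Set
MinimalColouring G f =
  Proper G 4 f ×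
  (∀ (g : Fin (m G) → Fin 4) → Proper G 4 g → ∀ i → colourCount G f zero ≤ colourCount G g i)

remove : (G : Graph) → EdgeSet G → Fin (m G) → EdgeSet G
remove G S e e' with e ≟ e'
... | Relation.Nullary.yes _ = false
... | Relation.Nullary.no _ = S e'

Conflicting : (G : Graph) → EdgeSet G → Set
Conflicting G S = ¬ ThreeColourableOn G S

MinimalConflicting : (G : Graph) → EdgeSet G → Set
MinimalConflicting G S =
  Conflicting G S × (∀ e → S e ≡ true → ThreeColourableOn G (remove G S e))

{-# OPTIONS --safe #-}
-- Let T consist of all edges except the conflicting edges other than e. T is not
-- 3-edge-colourable: a 3-colouring of T, shifted to the colours 1,2,3 and combined with
-- colour 0 on the edges outside T, would be a proper 4-colouring whose colour class 0
-- misses e and is otherwise inside f⁻¹(0), contradicting the minimality of f. Deleting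
-- the edges of T one at a time while T stays conflicting yields a minimal conflicting
-- subgraph S ⊆ T. It contains e, because T without e is 3-coloured by f itself.
module Submission where

open import Defs
open import Data.Bool using (true; false; if_then_else_) renaming (_≟_ to _≟ᵇ_)
open import Data.Empty using (⊥-elim)
open import Data.Fin using (Fin; zero; suc; finToFun; funToFin) renaming (_≟_ to _≟ᶠ_)
open import Data.Fin.Properties using (any?; all?; suc-injective; finToFun-funToFin)
open import Data.List using (List; []; _∷_; length; filter; foldl; allFin)
open import Data.List.Membership.Propositional using (_∈_)
open import Data.List.Membership.Propositional.Properties using (∈-allFin)
open import Data.List.Relation.Unary.Any using (here; there)
open import Data.Nat using (suc; _≤_; _<_; z≤n; s≤s)
open import Data.Nat.Properties using (m≤n⇒m≤1+n; <⇒≱)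
open import Data.Product using (Σ; ∃; _×_; _,_; proj₁)
open import Data.Sum using (inj₁; inj₂)
open import Function using (_∘_)
open import Relation.Nullary using (Dec; yes; no; does; ¬_; ¬?; contradiction)
open import Relation.Nullary.Decidable
  using (_×-dec_; _⊎-dec_; _→-dec_; map′; dec-true; decidable-stable)
open import Relation.Unary using (Pred; Decidable)
open import Relation.Binary.PropositionalEquality
  using (_≡_; _≢_; _≗_; refl; sym; trans)

does-true : ∀ {a} {A : Set a} (a? : Dec A) → does a? ≡ true → A
does-true (yes a) _ = a
does-true (no _) ()

does-false : ∀ {a} {A : Set a} (a? : Dec A) → does a? ≡ false → ¬ A
does-false (yes _) ()
does-false (no ¬a) _ = ¬a

-- A function Fin k → Fin l is enumerated through its code in Fin (l ^ k); without
-- function extensionality P has to be invariant under pointwise equality.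
any-function? : ∀ {k l p} {P : Pred (Fin k → Fin l) p} →
  (∀ {c c'} → c ≗ c' → P c → P c') → Decidable P → Dec (∃ P)
any-function? resp P? =
  map′ (λ (i , p) → finToFun i , p)
       (λ (c , p) → funToFin c , resp (sym ∘ finToFun-funToFin c) p)
       (any? (P? ∘ finToFun))

module _ {a p q} {A : Set a} {P : Pred A p} {Q : Pred A q}
         (P? : Decidable P) (Q? : Decidable Q) (P⇒Q : ∀ {x} → P x → Q x) where

  length-filter-mono : ∀ xs → length (filter P? xs) ≤ length (filter Q? xs)
  length-filter-mono [] = z≤n
  length-filter-mono (x ∷ xs) with P? x | Q? x
  ... | yes _  | yes _  = s≤s (length-filter-mono xs)
  ... | yes px | no ¬qx = contradiction (P⇒Q px) ¬qx
  ... | no _   | yes _  = m≤n⇒m≤1+n (length-filter-mono xs)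
  ... | no _   | no _   = length-filter-mono xs

  length-filter-mono-< : ∀ {xs y} → y ∈ xs → Q y → ¬ P y →
                         length (filter P? xs) < length (filter Q? xs)
  length-filter-mono-< {x ∷ xs} (here refl) qx ¬px with P? x | Q? x
  ... | yes px | _      = contradiction px ¬px
  ... | no _   | yes _  = s≤s (length-filter-mono xs)
  ... | no _   | no ¬qx = contradiction qx ¬qx
  length-filter-mono-< {x ∷ xs} (there y∈xs) qy ¬py with P? x | Q? x
  ... | yes _  | yes _  = s≤s (length-filter-mono-< y∈xs qy ¬py)
  ... | yes px | no ¬qx = contradiction (P⇒Q px) ¬qx
  ... | no _   | yes _  = m≤n⇒m≤1+n (length-filter-mono-< y∈xs qy ¬py)
  ... | no _   | no _   = length-filter-mono-< y∈xs qy ¬py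

unshift : ∀ {k} → Fin (suc (suc k)) → Fin (suc k)
unshift zero    = zero
unshift (suc a) = a

unshift-injective : ∀ {k} {a b : Fin (suc (suc k))} → a ≢ zero → b ≢ zero →
                    unshift a ≡ unshift b → a ≡ b
unshift-injective {a = zero}  a≢0 _   _    = contradiction refl a≢0
unshift-injective {a = suc _} {zero}  _ b≢0 _ = contradiction refl b≢0
unshift-injective {a = suc _} {suc _} _ _ refl = refl

module _ (G : Graph) where

  private
    E : Set
    E = Fin (m G)

  _⊆_ : EdgeSet G → EdgeSet G → Set
  S ⊆ T = ∀ x → S x ≡ true → T x ≡ true

  remove-≢ : ∀ S d {x} → remove G S d x ≡ true → d ≢ x
  remove-≢ S d {x} eq with d ≟ᶠ x
  remove-≢ S d () | yes _
  ... | no d≢x = d≢x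

  remove-⊆ : ∀ S d → remove G S d ⊆ S
  remove-⊆ S d x eq with d ≟ᶠ x
  remove-⊆ S d x () | yes _
  ... | no _ = eq

  remove-mono : ∀ {S T} d → S ⊆ T → remove G S d ⊆ remove G T d
  remove-mono d S⊆T x eq with d ≟ᶠ x
  remove-mono d S⊆T x () | yes _
  ... | no _ = S⊆T x eq

  ⊆-remove : ∀ {S T} d → S ⊆ T → S d ≡ false → S ⊆ remove G T d
  ⊆-remove d S⊆T Sd≡false x Sx with d ≟ᶠ x
  ... | yes refl = contradiction (trans (sym Sd≡false) Sx) λ ()
  ... | no _     = S⊆T x Sx

  properOn-antimono : ∀ {k S T} {c : E → Fin k} → S ⊆ T → ProperOn G k T c → ProperOn G k S c
  properOn-antimono S⊆T pc x y Sx Sy = pc x y (S⊆T x Sx) (S⊆T y Sy)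

  colourable-antimono : ∀ {S T} → S ⊆ T → ThreeColourableOn G T → ThreeColourableOn G S
  colourable-antimono S⊆T (c , pc) = c , properOn-antimono S⊆T pc

  properOn-resp : ∀ {k S} {c c' : E → Fin k} → c ≗ c' → ProperOn G k S c → ProperOn G k S c'
  properOn-resp c≗c' pc x y Sx Sy adj c'x≡c'y =
    pc x y Sx Sy adj (trans (c≗c' x) (trans c'x≡c'y (sym (c≗c' y))))

  adjacent? : ∀ e e' → Dec (Adjacent G e e')
  adjacent? e e' = ¬? (e ≟ᶠ e') ×-dec any? λ v → incident? e v ×-dec incident? e' v
    where
    incident? : ∀ e v → Dec (Incident G e v)
    incident? e v = (end₁ G e ≟ᶠ v) ⊎-dec (end₂ G e ≟ᶠ v)

  properOn? : ∀ {k} S (c : E → Fin k) → Dec (ProperOn G k S c)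
  properOn? S c = all? λ x → all? λ y →
    (S x ≟ᵇ true) →-dec ((S y ≟ᵇ true) →-dec (adjacent? x y →-dec ¬? (c x ≟ᶠ c y)))

  -- Opaque so that `with threeColourable? …` abstracts over an unreduced decision.
  opaque
    threeColourable? : ∀ S → Dec (ThreeColourableOn G S)
    threeColourable? S = any-function? properOn-resp (properOn? S)

  shrinkAt : EdgeSet G → E → EdgeSet G
  shrinkAt T d with threeColourable? (remove G T d)
  ... | yes _ = T
  ... | no _  = remove G T d

  shrink : List E → EdgeSet G → EdgeSet G
  shrink ds T = foldl shrinkAt T ds

  shrinkAt-⊆ : ∀ T d → shrinkAt T d ⊆ T
  shrinkAt-⊆ T d x eq with threeColourable? (remove G T d)
  ... | yes _ = eq
  ... | no _  = remove-⊆ T d x eq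

  shrinkAt-conflicting : ∀ T d → Conflicting G T → Conflicting G (shrinkAt T d)
  shrinkAt-conflicting T d conflictT with threeColourable? (remove G T d)
  ... | yes _           = conflictT
  ... | no conflictT-d  = conflictT-d

  shrink-⊆ : ∀ ds T → shrink ds T ⊆ T
  shrink-⊆ []       T x eq = eq
  shrink-⊆ (d ∷ ds) T x eq = shrinkAt-⊆ T d x (shrink-⊆ ds (shrinkAt T d) x eq)

  shrink-conflicting : ∀ ds T → Conflicting G T → Conflicting G (shrink ds T)
  shrink-conflicting []       T conflictT = conflictT
  shrink-conflicting (d ∷ ds) T conflictT =
    shrink-conflicting ds (shrinkAt T d) (shrinkAt-conflicting T d conflictT)

  -- An edge that was kept when its turn came is kept because removing it made the
  -- current set colourable, and later sets are smaller.
  shrink-critical : ∀ ds T d → d ∈ ds → shrink ds T d ≡ true →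
                    ThreeColourableOn G (remove G (shrink ds T) d)
  shrink-critical (d ∷ ds) T d (here refl) eq with threeColourable? (remove G T d)
  ... | yes colourableT-d = colourable-antimono (remove-mono d (shrink-⊆ ds T)) colourableT-d
  ... | no _              = contradiction refl (remove-≢ T d (shrink-⊆ ds (remove G T d) d eq))
  shrink-critical (x ∷ ds) T d (there d∈ds) eq = shrink-critical ds (shrinkAt T x) d d∈ds eq

  minimalConflicting-⊆ : ∀ T → Conflicting G T →
    Σ (EdgeSet G) λ S → S ⊆ T × MinimalConflicting G S
  minimalConflicting-⊆ T conflictT =
    shrink (allFin _) T ,
    shrink-⊆ (allFin _) T ,
    shrink-conflicting (allFin _) T conflictT ,
    λ d Sd → shrink-critical (allFin _) T d (∈-allFin d) Sd

  conflicting-contains-critical : ∀ {S T d} → Conflicting G S → S ⊆ T →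
    ThreeColourableOn G (remove G T d) → S d ≡ true
  conflicting-contains-critical {S} {d = d} conflictS S⊆T colourableT-d with S d in Sd
  ... | true  = refl
  ... | false = ⊥-elim (conflictS (colourable-antimono (⊆-remove d S⊆T Sd) colourableT-d))

  properOn-unshift : ∀ {k S} {f : E → Fin (suc (suc k))} → ProperOn G _ S f →
    (∀ x → S x ≡ true → f x ≢ zero) → ProperOn G (suc k) S (unshift ∘ f)
  properOn-unshift pf nonzero x y Sx Sy adj =
    pf x y Sx Sy adj ∘ unshift-injective (nonzero x Sx) (nonzero y Sy)

  recolour : ∀ {k} → EdgeSet G → (E → Fin k) → E → Fin (suc k)
  recolour S c x = if S x then suc (c x) else zero

  recolour-zero : ∀ {k S} {c : E → Fin k} {x} → recolour S c x ≡ zero → S x ≡ false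
  recolour-zero {S = S} {x = x} eq with S x
  recolour-zero () | true
  ... | false = refl

  recolour-proper : ∀ {k S} {f : E → Fin (suc k)} {c : E → Fin k} → Proper G _ f →
    (∀ x → S x ≡ false → f x ≡ zero) → ProperOn G k S c → Proper G (suc k) (recolour S c)
  recolour-proper {S = S} pf outside-zero pc x y _ _ adj with S x in Sx | S y in Sy
  ... | true  | true  = pc x y Sx Sy adj ∘ suc-injective
  ... | true  | false = λ ()
  ... | false | true  = λ ()
  ... | false | false = λ _ →
    pf x y refl refl adj (trans (outside-zero x Sx) (sym (outside-zero y Sy)))

  colourCount-zero-< : ∀ {k} (g f : E → Fin (suc k)) {e} →
    (∀ x → g x ≡ zero → f x ≡ zero) → g e ≢ zero → f e ≡ zero →
    colourCount G g zero < colourCount G f zero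
  colourCount-zero-< g f {e} g⇒f ge fe =
    length-filter-mono-< (λ x → g x ≟ᶠ zero) (λ x → f x ≟ᶠ zero) (g⇒f _) (∈-allFin e) fe ge

  nonzeroOr : ∀ {k} → (E → Fin (suc k)) → E → EdgeSet G
  nonzeroOr f e x = does (¬? (f x ≟ᶠ zero) ⊎-dec (x ≟ᶠ e))

  module _ {k} (f : E → Fin (suc k)) (e : E) where

    nonzeroOr-self : nonzeroOr f e e ≡ true
    nonzeroOr-self = dec-true (¬? (f e ≟ᶠ zero) ⊎-dec (e ≟ᶠ e)) (inj₂ refl)

    nonzeroOr-false : ∀ x → nonzeroOr f e x ≡ false → f x ≡ zero
    nonzeroOr-false x eq = decidable-stable (f x ≟ᶠ zero) (does-false (¬? (f x ≟ᶠ zero) ⊎-dec (x ≟ᶠ e)) eq ∘ inj₁)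

    nonzeroOr-zero : ∀ {x} → nonzeroOr f e x ≡ true → f x ≡ zero → x ≡ e
    nonzeroOr-zero {x} eq fx≡0 with does-true (¬? (f x ≟ᶠ zero) ⊎-dec (x ≟ᶠ e)) eq
    ... | inj₁ fx≢0 = contradiction fx≡0 fx≢0
    ... | inj₂ x≡e  = x≡e

  remove-nonzeroOr-colourable : ∀ {f : E → Fin 4} e → Proper G 4 f →
    ThreeColourableOn G (remove G (nonzeroOr f e) e)
  remove-nonzeroOr-colourable {f} e pf =
    unshift ∘ f , properOn-unshift (properOn-antimono (λ _ _ → refl) pf) nonzero
    where
    nonzero : ∀ x → remove G (nonzeroOr f e) e x ≡ true → f x ≢ zero
    nonzero x eq fx≡0 =
      remove-≢ _ e eq (sym (nonzeroOr-zero f e (remove-⊆ (nonzeroOr f e) e x eq) fx≡0))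

  nonzeroOr-conflicting : ∀ {f : E → Fin 4} {e} → MinimalColouring G f → f e ≡ zero →
    Conflicting G (nonzeroOr f e)
  nonzeroOr-conflicting {f} {e} (pf , f-minimal) fe≡0 (c , pc) =
    <⇒≱ (colourCount-zero-< g f g⇒f ge≢0 fe≡0) (f-minimal g g-proper zero)
    where
    g : E → Fin 4
    g = recolour (nonzeroOr f e) c

    g-proper : Proper G 4 g
    g-proper = recolour-proper pf (nonzeroOr-false f e) pc

    g⇒f : ∀ x → g x ≡ zero → f x ≡ zero
    g⇒f x = nonzeroOr-false f e x ∘ recolour-zero {S = nonzeroOr f e} {c} {x}

    ge≢0 : g e ≢ zero
    ge≢0 ge≡0 = contradiction (trans (sym (nonzeroOr-self f e)) (recolour-zero {S = nonzeroOr f e} {c} ge≡0)) λ ()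

proposition2p4 : (G : Graph) → Subcubic G → ClassTwo G →
    (f : Fin (m G) → Fin 4) → MinimalColouring G f →
    (e : Fin (m G)) → f e ≡ zero →
    Σ (EdgeSet G) λ S → MinimalConflicting G S × S e ≡ true ×
      (∀ e' → S e' ≡ true → f e' ≡ zero → e' ≡ e)
proposition2p4 G _ _ f minimal-f e fe≡0
  with minimalConflicting-⊆ G (nonzeroOr G f e) (nonzeroOr-conflicting G minimal-f fe≡0)
... | S , S⊆T , minimalS@(conflictS , _) =
  S , minimalS ,
  conflicting-contains-critical G conflictS S⊆T (remove-nonzeroOr-colourable G e (proj₁ minimal-f)) ,
  λ x Sx fx≡0 → nonzeroOr-zero G f e (S⊆T x Sx) fx≡0
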